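{- Let $p$ be a prime and $r\in\mathbb{Z}$. Consider $Powerset(\omega)$, the Boolean algebra of all subsets of $\omega$, as a structure with the Boolean operations $0,1,\cap,\cup,\neg$, the predicates $C_k$ ($k\geq1$) where $C_k(x)$ means $x$ has at least $k$ elements, the predicate $Fin(x)$ meaning $x$ is finite, and, for every prime $q\neq p$, every $m\geq 1$ and every $s\in\mathbb{Z}$, the predicate $Res(q^m,s)(x)$ meaning $x$ is finite and $|x|\equiv s\pmod{q^m}$. Then the set $\{x\subseteq\omega: x \text{ finite and } |x|\equiv r\pmod p\}$ is not definable in this structure (by a formula with one free variable and no parameters). -}

module Defs where

open import Level using (0ℓ)
open import Data.Nat using (ℕ; zero; suc; _+_; _^_; _≤_)
open import Data.Nat.Primality using (Prime)
open import Data.Integer as ℤ using (ℤ; +_; _-_)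
open import Data.Integer.Divisibility as ℤD using ()
open import Data.Bool using (Bool; true; false; if_then_else_; _∧_; _∨_; not)
open import Data.Fin using (Fin)
open import Data.Product using (Σ; ∃; _×_)
open import Data.Sum using (_⊎_)
open import Data.Empty using (⊥)
open import Relation.Binary.PropositionalEquality using (_≡_; _≢_)
open import Data.Vec.Functional using (_∷_)

Subset : Set
Subset = ℕ → Bool

count : Subset → ℕ → ℕ
count x zero = 0
count x (suc N) = count x N + (if x N then 1 else 0)

IsFinite : Subset → Set
IsFinite x = Σ ℕ λ N → ∀ i → N ≤ i → x i ≡ false

HasCard : Subset → ℕ → Set
HasCard x c = Σ ℕ λ N → (∀ i → N ≤ i → x i ≡ false) × (count x N ≡ c)

AtLeast : ℕ → Subset → Set
AtLeast k x = Σ ℕ λ N → k ≤ count x N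

ResPred : ℕ → ℤ → Subset → Set
ResPred n s x = Σ ℕ λ c → HasCard x c × (+ n ℤD.∣ (+ c - s))

data Term (n : ℕ) : Set where
  var : Fin n → Term n
  𝟘 𝟙 : Term n
  _⊓_ _⊔_ : Term n → Term n → Term n
  ∁ : Term n → Term n

data Formula (p : ℕ) : ℕ → Set where
  _≐_   : ∀ {n} → Term n → Term n → Formula p n
  Cₖ    : ∀ {n} (k : ℕ) → 1 ≤ k → Term n → Formula p n
  Fin′  : ∀ {n} → Term n → Formula p n
  Res   : ∀ {n} (q m : ℕ) → Prime q → q ≢ p → 1 ≤ m → ℤ → Term n → Formula p n
  ⊥′    : ∀ {n} → Formula p n
  _∧′_  : ∀ {n} → Formula p n → Formula p n → Formula p n
  _∨′_  : ∀ {n} → Formula p n → Formula p n → Formula p n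
  _⇒′_  : ∀ {n} → Formula p n → Formula p n → Formula p n
  ¬′_   : ∀ {n} → Formula p n → Formula p n
  ∀′    : ∀ {n} → Formula p (suc n) → Formula p n
  ∃′    : ∀ {n} → Formula p (suc n) → Formula p n

Env : ℕ → Set
Env n = Fin n → Subset

evalT : ∀ {n} → Term n → Env n → Subset
evalT (var i) ρ = ρ i
evalT 𝟘 ρ = λ _ → false
evalT 𝟙 ρ = λ _ → true
evalT (s ⊓ t) ρ = λ i → evalT s ρ i ∧ evalT t ρ i
evalT (s ⊔ t) ρ = λ i → evalT s ρ i ∨ evalT t ρ i
evalT (∁ t) ρ = λ i → not (evalT t ρ i)

Sat : ∀ {p n} → Formula p n → Env n → Set
Sat (s ≐ t) ρ = ∀ i → evalT s ρ i ≡ evalT t ρ i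
Sat (Cₖ k _ t) ρ = AtLeast k (evalT t ρ)
Sat (Fin′ t) ρ = IsFinite (evalT t ρ)
Sat (Res q m _ _ _ s t) ρ = ResPred (q ^ m) s (evalT t ρ)
Sat ⊥′ ρ = ⊥
Sat (φ ∧′ ψ) ρ = Sat φ ρ × Sat ψ ρ
Sat (φ ∨′ ψ) ρ = Sat φ ρ ⊎ Sat ψ ρ
Sat (φ ⇒′ ψ) ρ = Sat φ ρ → Sat ψ ρ
Sat (¬′ φ) ρ = Sat φ ρ → ⊥
Sat (∀′ φ) ρ = (y : Subset) → Sat φ (y ∷ ρ)
Sat (∃′ φ) ρ = Σ Subset λ y → Sat φ (y ∷ ρ)

Definable : (p : ℕ) → (Subset → Set) → Set
Definable p T = Σ (Formula p 1) λ φ →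
  ∀ (x : Subset) → (Sat φ (λ _ → x) → T x) × (T x → Sat φ (λ _ → x))

module Submission where

-- The proof is an Ehrenfeucht–Fraïssé argument.  To a formula φ we attach a modulus M (the
-- product of the moduli q^m of its Res-atoms, hence prime to p) and a threshold T (from its
-- counting atoms, growing to T + M + T under each quantifier).  Two finite cardinalities are
-- (M,T)-equivalent if they are equal, or both ≥ T and congruent mod M; two sets are equivalent if
-- both are infinite, or both finite with equivalent cardinalities; two environments are
-- equivalent if the corresponding Boolean cells of their variables are.
--
-- Finally, the initial segments of sizes a and a + M, with a ≥ T and
-- a ≡ r (mod p), are equivalent, so a formula defining Res(p, r) would force p ∣ M.

open import Defs
open import Level using (0ℓ)
open import Axiom.ExcludedMiddle using (ExcludedMiddle)
open import Algebra.Bundles using (CommutativeMonoid)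
open import Data.Bool using (Bool; true; false; if_then_else_; _∧_; _∨_; not; _xor_)
open import Data.Bool.Properties using (∧-zeroʳ; ∧-identityʳ; ∧-commutativeMonoid; not-involutive; xor-same)
open import Data.Empty using (⊥-elim)
open import Data.Fin using (zero; suc)
open import Data.Integer as ℤ using (ℤ; +_; _%ℕ_; _/ℕ_)
open import Data.Integer.DivMod using (a≡a%ℕn+[a/ℕn]*n)
import Data.Integer.Divisibility as ℤD
import Data.Integer.Divisibility.Signed as ℤS
import Data.Integer.Properties as ℤP
import Data.Nat.Divisibility as ℕD
open import Data.Nat.Primality using (Prime; prime⇒nonZero; euclidsLemma; prime⇒irreducible; ¬prime[1])
open import Data.Integer.Tactic.RingSolver using (solve-∀)
open import Data.Nat
  using (ℕ; zero; suc; _+_; _*_; _∸_; _^_; _≤_; _<_; _≤′_; ≤′-refl; ≤′-step; z≤n; s≤s; _<ᵇ_; NonZero; _<?_; _%_; _/_)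
  renaming (_⊓_ to _min_; _⊔_ to _max_)
open import Data.Nat.Properties
open import Data.Nat.DivMod using (m%n<n; m≡m%n+[m/n]*n)
open import Data.Product using (Σ; _×_; _,_; proj₁; proj₂)
open import Data.Sum using (inj₁; inj₂)
open import Data.Vec using (Vec; []; _∷_; tabulate; lookup)
open import Data.Vec.Properties using (lookup∘tabulate)
import Data.Vec.Functional as VF
open import Function using (_∘_; flip; id)
open import Relation.Nullary using (¬_; yes; no)
open import Relation.Binary.PropositionalEquality

open import Algebra.Properties.CommutativeSemigroup +-commutativeSemigroup using (interchange)
open import Algebra.Properties.CommutativeSemigroup
  (CommutativeMonoid.commutativeSemigroup ∧-commutativeMonoid) using () renaming (xy∙z≈xz∙y to ∧-swapʳ)

-- Excluded middle is needed: finiteness of a set is not decidable.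
EM : Set₁
EM = ExcludedMiddle 0ℓ

infixl 7 _∩_ _∖_
infixl 6 _∪_
infix 4 _⊆_

_∩_ _∖_ _∪_ : Subset → Subset → Subset
(A ∩ B) i = A i ∧ B i
(A ∖ B) i = A i ∧ not (B i)
(A ∪ B) i = A i ∨ B i

∅ ω : Subset
∅ _ = false
ω _ = true

_⊆_ : Subset → Subset → Set
B ⊆ A = ∀ i → B i ≡ true → A i ≡ true

Disjoint : Subset → Subset → Set
Disjoint A B = ∀ i → A i ∧ B i ≡ false

BoundedBy : Subset → ℕ → Set
BoundedBy A N = ∀ i → N ≤ i → A i ≡ false

bit : Bool → ℕ
bit b = if b then 1 else 0

count-≗ : ∀ {A B} → A ≗ B → ∀ N → count A N ≡ count B N
count-≗ e zero = refl
count-≗ e (suc N) = cong₂ (λ c b → c + bit b) (count-≗ e N) (e N)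

bit-∨ : ∀ a b → a ∧ b ≡ false → bit (a ∨ b) ≡ bit a + bit b
bit-∨ false b _ = refl
bit-∨ true false _ = refl

count-∪ : ∀ {A B} → Disjoint A B → ∀ N → count (A ∪ B) N ≡ count A N + count B N
count-∪ d zero = refl
count-∪ {A} {B} d (suc N) = begin
  count (A ∪ B) N + bit (A N ∨ B N)                  ≡⟨ cong₂ _+_ (count-∪ d N) (bit-∨ (A N) (B N) (d N)) ⟩
  (count A N + count B N) + (bit (A N) + bit (B N))  ≡⟨ interchange (count A N) _ _ _ ⟩
  (count A N + bit (A N)) + (count B N + bit (B N))  ∎
  where open ≡-Reasoning

count-mono : ∀ A {N N'} → N ≤ N' → count A N ≤ count A N'
count-mono A = go ∘ ≤⇒≤′
  where
  go : ∀ {N N'} → N ≤′ N' → count A N ≤ count A N'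
  go ≤′-refl = ≤-refl
  go (≤′-step le) = ≤-trans (go le) (m≤m+n _ _)

count-stable : ∀ A {N N'} → BoundedBy A N → N ≤ N' → count A N' ≡ count A N
count-stable A {N} b = go ∘ ≤⇒≤′
  where
  go : ∀ {M} → N ≤′ M → count A M ≡ count A N
  go ≤′-refl = refl
  go (≤′-step {M} le) rewrite b M (≤′⇒≤ le) = trans (+-identityʳ _) (go le)

count≤count-at-bound : ∀ A {N} → BoundedBy A N → ∀ N' → count A N' ≤ count A N
count≤count-at-bound A {N} b N' = begin
  count A N'         ≤⟨ count-mono A (m≤m⊔n N' N) ⟩
  count A (N' max N) ≡⟨ count-stable A b (m≤n⊔m N' N) ⟩
  count A N          ∎
  where open ≤-Reasoning

hasCard-unique : ∀ {A c c'} → HasCard A c → HasCard A c' → c ≡ c'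
hasCard-unique {A} (N , b , refl) (N' , b' , refl) =
  trans (sym (count-stable A b (m≤m⊔n N N'))) (count-stable A b' (m≤n⊔m N N'))

hasCard⇒finite : ∀ {A c} → HasCard A c → IsFinite A
hasCard⇒finite (N , b , _) = N , b

finite⇒hasCard : ∀ {A} → IsFinite A → Σ ℕ (HasCard A)
finite⇒hasCard {A} (N , b) = count A N , N , b , refl

⊆-boundedBy : ∀ {A B N} → B ⊆ A → BoundedBy A N → BoundedBy B N
⊆-boundedBy {A} {B} B⊆A b i le with B i in eq
... | false = refl
... | true = sym (trans (sym (b i le)) (B⊆A i eq))

⊆-finite : ∀ {A B} → B ⊆ A → IsFinite A → IsFinite B
⊆-finite B⊆A (N , b) = N , ⊆-boundedBy B⊆A b

≗⇒⊆ : ∀ {A B} → A ≗ B → A ⊆ B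
≗⇒⊆ e i Ai = trans (sym (e i)) Ai

hasCard-≗ : ∀ {A B c} → A ≗ B → HasCard A c → HasCard B c
hasCard-≗ e (N , b , eq) = N , ⊆-boundedBy (≗⇒⊆ (sym ∘ e)) b , trans (sym (count-≗ e N)) eq

finite-≗ : ∀ {A B} → A ≗ B → IsFinite A → IsFinite B
finite-≗ e = ⊆-finite (≗⇒⊆ (sym ∘ e))

∪-boundedBy : ∀ {A B N N'} → BoundedBy A N → BoundedBy B N' → BoundedBy (A ∪ B) (N max N')
∪-boundedBy {N = N} {N'} b b' i le
  rewrite b i (≤-trans (m≤m⊔n N N') le) | b' i (≤-trans (m≤n⊔m N N') le) = refl

∪-finite : ∀ {A B} → IsFinite A → IsFinite B → IsFinite (A ∪ B)
∪-finite (N , b) (N' , b') = N max N' , ∪-boundedBy b b'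

∪-hasCard : ∀ {A B a b} → Disjoint A B → HasCard A a → HasCard B b → HasCard (A ∪ B) (a + b)
∪-hasCard {A} {B} d (N , bA , refl) (N' , bB , refl) = N max N' , ∪-boundedBy bA bB ,
  trans (count-∪ d (N max N'))
        (cong₂ _+_ (count-stable A bA (m≤m⊔n N N')) (count-stable B bB (m≤n⊔m N N')))

⊆-∪ˡ : ∀ {A B} → A ⊆ A ∪ B
⊆-∪ˡ i Ai rewrite Ai = refl

⊆-∪ʳ : ∀ {A B} → B ⊆ A ∪ B
⊆-∪ʳ {A} i Bi rewrite Bi with A i
... | true = refl
... | false = refl

infinite⇒unbounded : EM → ∀ {A} → ¬ IsFinite A → ∀ K → Σ ℕ λ N → K ≤ count A N
infinite⇒unbounded em {A} inf zero = 0 , z≤n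
infinite⇒unbounded em {A} inf (suc K) with infinite⇒unbounded em inf K
... | N , K≤ with em {Σ ℕ λ i → N ≤ i × A i ≡ true}
... | yes (i , N≤i , Ai) = suc i , (begin
        suc K                       ≤⟨ s≤s (≤-trans K≤ (count-mono A N≤i)) ⟩
        suc (count A i)             ≡⟨ +-comm 1 (count A i) ⟩
        count A i + 1               ≡⟨ cong (λ b → count A i + bit b) (sym Ai) ⟩
        count A i + bit (A i)       ∎)
  where open ≤-Reasoning
... | no ∄i = ⊥-elim (inf (N , bounded))
  where
  bounded : BoundedBy A N
  bounded i N≤i with A i in eq
  ... | false = refl
  ... | true = ⊥-elim (∄i (i , N≤i , eq))

empty⇒hasCard0 : ∀ {A} → A ≗ ∅ → HasCard A 0
empty⇒hasCard0 e = 0 , (λ i _ → e i) , refl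

hasCard0⇒empty : ∀ {A} → HasCard A 0 → A ≗ ∅
hasCard0⇒empty {A} (N , b , eq) i with A i in Ai
... | false = refl
... | true = ⊥-elim (1+n≰n (begin
  1                    ≤⟨ m≤n+m 1 (count A i) ⟩
  count A i + 1        ≡⟨ cong (λ b → count A i + bit b) (sym Ai) ⟩
  count A (suc i)      ≤⟨ count≤count-at-bound A b (suc i) ⟩
  count A N            ≡⟨ eq ⟩
  0                    ∎))
  where open ≤-Reasoning

infix 4 _≡_mod_

record _≡_mod_ (a b M : ℕ) : Set where
  constructor mkMod
  field divides-difference : + M ℤS.∣ (+ a ℤ.- + b)
open _≡_mod_

mod-by-multiple : ∀ {M a b} q → a ≡ b + q * M → a ≡ b mod M
mod-by-multiple {M} {b = b} q refl = mkMod (ℤS.divides (+ q) (begin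
  + (b + q * M) ℤ.- + b
    ≡⟨ cong (ℤ._- + b) (trans (ℤP.pos-+ b (q * M)) (cong (ℤ._+_ (+ b)) (ℤP.pos-* q M))) ⟩
  (+ b ℤ.+ + q ℤ.* + M) ℤ.- + b ≡⟨ x+y-x≡y (+ b) _ ⟩
  + q ℤ.* + M                   ∎))
  where
  open ≡-Reasoning
  x+y-x≡y : ∀ x y → (x ℤ.+ y) ℤ.- x ≡ y
  x+y-x≡y = solve-∀

mod-refl : ∀ {M a} → a ≡ a mod M
mod-refl {a = a} = mod-by-multiple 0 (sym (+-identityʳ a))

mod-sym : ∀ {M a b} → a ≡ b mod M → b ≡ a mod M
mod-sym {M} {a} {b} (mkMod d) = mkMod (subst (+ M ℤS.∣_) (neg-diff (+ a) (+ b)) (ℤS.∣m⇒∣-m d))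
  where
  neg-diff : ∀ x y → ℤ.- (x ℤ.- y) ≡ y ℤ.- x
  neg-diff = solve-∀

mod-+ : ∀ {M a b c d} → a ≡ c mod M → b ≡ d mod M → a + b ≡ c + d mod M
mod-+ {M} {a} {b} {c} {d} (mkMod h) (mkMod h') = mkMod (subst (+ M ℤS.∣_)
  (trans (sum-diffs (+ a) (+ b) (+ c) (+ d)) (sym (cong₂ ℤ._-_ (ℤP.pos-+ a b) (ℤP.pos-+ c d))))
  (ℤS.∣m∣n⇒∣m+n h h'))
  where
  sum-diffs : ∀ x y z w → (x ℤ.- z) ℤ.+ (y ℤ.- w) ≡ (x ℤ.+ y) ℤ.- (z ℤ.+ w)
  sum-diffs = solve-∀

mod-cancelˡ : ∀ {M a b c d} → a + b ≡ c + d mod M → a ≡ c mod M → b ≡ d mod M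
mod-cancelˡ {M} {a} {b} {c} {d} (mkMod h) (mkMod h') = mkMod (subst (+ M ℤS.∣_)
  (diff-of-diffs (+ a) (+ b) (+ c) (+ d))
  (ℤS.∣m∣n⇒∣m-n (subst (+ M ℤS.∣_) (cong₂ ℤ._-_ (ℤP.pos-+ a b) (ℤP.pos-+ c d)) h) h'))
  where
  diff-of-diffs : ∀ x y z w → ((x ℤ.+ y) ℤ.- (z ℤ.+ w)) ℤ.- (x ℤ.- z) ≡ y ℤ.- w
  diff-of-diffs = solve-∀


mod-∣ : ∀ {M M' a b} → M' ℕD.∣ M → a ≡ b mod M → a ≡ b mod M'
mod-∣ {M} {M'} d (mkMod h) = mkMod (ℤS.∣-trans (ℤS.∣ᵤ⇒∣ {+ M'} {+ M} d) h)

mod-shift⇒∣ : ∀ {M a k} → a + k ≡ a mod M → M ℕD.∣ k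
mod-shift⇒∣ {M} {a} {k} h =
  subst (M ℕD.∣_) (+-identityʳ k) (ℤS.∣⇒∣ᵤ (divides-difference k≡0))
  where
  k≡0 : k ≡ 0 mod M
  k≡0 = mod-cancelˡ (subst (λ x → a + k ≡ x mod M) (sym (+-identityʳ a)) h) mod-refl

mod-residue : ∀ {n c c' s} → c ≡ c' mod n → + n ℤD.∣ (+ c ℤ.- s) → + n ℤD.∣ (+ c' ℤ.- s)
mod-residue {n} {c} {c'} {s} (mkMod h) r = ℤS.∣⇒∣ᵤ (subst (+ n ℤS.∣_) (shift-base (+ c) s (+ c'))
  (ℤS.∣m∣n⇒∣m-n (ℤS.∣ᵤ⇒∣ {+ n} {+ c ℤ.- s} r) h))
  where
  shift-base : ∀ x y z → (x ℤ.- y) ℤ.- (x ℤ.- z) ≡ z ℤ.- y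
  shift-base = solve-∀

residue⇒mod : ∀ {n c c' s} → + n ℤD.∣ (+ c ℤ.- s) → + n ℤD.∣ (+ c' ℤ.- s) → c ≡ c' mod n
residue⇒mod {n} {c} {c'} {s} r r' = mkMod (subst (+ n ℤS.∣_) (cancel-base (+ c) s (+ c'))
  (ℤS.∣m∣n⇒∣m-n (ℤS.∣ᵤ⇒∣ {+ n} {+ c ℤ.- s} r) (ℤS.∣ᵤ⇒∣ {+ n} {+ c' ℤ.- s} r')))
  where
  cancel-base : ∀ x y z → (x ℤ.- y) ℤ.- (z ℤ.- y) ≡ x ℤ.- z
  cancel-base = solve-∀

-- A formula whose Res-atoms have moduli dividing M and whose counting
-- atoms C_k have k ≤ T cannot tell apart two finite cardinalities that are
-- equal, or both at least T and congruent mod M.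

data NumEquiv (M T c c' : ℕ) : Set where
  equal : c ≡ c' → NumEquiv M T c c'
  large : T ≤ c → T ≤ c' → c ≡ c' mod M → NumEquiv M T c c'

numEquiv⇒mod : ∀ {M T c c'} → NumEquiv M T c c' → c ≡ c' mod M
numEquiv⇒mod (equal refl) = mod-refl
numEquiv⇒mod (large _ _ h) = h

numEquiv-sym : ∀ {M T c c'} → NumEquiv M T c c' → NumEquiv M T c' c
numEquiv-sym (equal e) = equal (sym e)
numEquiv-sym (large a b h) = large b a (mod-sym h)

numEquiv-weaken : ∀ {M T M' T' c c'} → M' ℕD.∣ M → T' ≤ T → NumEquiv M T c c' → NumEquiv M' T' c c'
numEquiv-weaken d le (equal e) = equal e
numEquiv-weaken d le (large a b h) = large (≤-trans le a) (≤-trans le b) (mod-∣ d h)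

numEquiv-+ : ∀ {M T a b c d} → NumEquiv M T a c → NumEquiv M T b d → NumEquiv M T (a + b) (c + d)
numEquiv-+ (equal refl) (equal refl) = equal refl
numEquiv-+ {a = a} {b} {c} {d} (large Ta Tc h) e =
  large (≤-trans Ta (m≤m+n a b)) (≤-trans Tc (m≤m+n c d)) (mod-+ h (numEquiv⇒mod e))
numEquiv-+ {a = a} {b} {c} {d} e@(equal _) (large Tb Td h) =
  large (≤-trans Tb (m≤n+m b a)) (≤-trans Td (m≤n+m d c)) (mod-+ (numEquiv⇒mod e) h)

data SetEquiv (M T : ℕ) (A A' : Subset) : Set where
  both-infinite : ¬ IsFinite A → ¬ IsFinite A' → SetEquiv M T A A'
  both-finite : ∀ {c c'} → HasCard A c → HasCard A' c' → NumEquiv M T c c' → SetEquiv M T A A'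

setEquiv-sym : ∀ {M T A A'} → SetEquiv M T A A' → SetEquiv M T A' A
setEquiv-sym (both-infinite a a') = both-infinite a' a
setEquiv-sym (both-finite h h' e) = both-finite h' h (numEquiv-sym e)

setEquiv-weaken : ∀ {M T M' T' A A'} → M' ℕD.∣ M → T' ≤ T → SetEquiv M T A A' → SetEquiv M' T' A A'
setEquiv-weaken d le (both-infinite a a') = both-infinite a a'
setEquiv-weaken d le (both-finite h h' e) = both-finite h h' (numEquiv-weaken d le e)

setEquiv-≗ : ∀ {M T A A' B B'} → A ≗ B → A' ≗ B' → SetEquiv M T A A' → SetEquiv M T B B'
setEquiv-≗ e e' (both-infinite a a') =
  both-infinite (a ∘ finite-≗ (sym ∘ e)) (a' ∘ finite-≗ (sym ∘ e'))
setEquiv-≗ e e' (both-finite h h' c) = both-finite (hasCard-≗ e h) (hasCard-≗ e' h') c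

setEquiv-∅ : ∀ {M T} → SetEquiv M T ∅ ∅
setEquiv-∅ = both-finite (empty⇒hasCard0 (λ _ → refl)) (empty⇒hasCard0 (λ _ → refl)) (equal refl)

setEquiv-∪ : ∀ {M T A A' B B'} → Disjoint A B → Disjoint A' B' →
             SetEquiv M T A A' → SetEquiv M T B B' → SetEquiv M T (A ∪ B) (A' ∪ B')
setEquiv-∪ d d' (both-infinite a a') _ =
  both-infinite (a ∘ ⊆-finite ⊆-∪ˡ) (a' ∘ ⊆-finite ⊆-∪ˡ)
setEquiv-∪ d d' (both-finite _ _ _) (both-infinite b b') =
  both-infinite (b ∘ ⊆-finite ⊆-∪ʳ) (b' ∘ ⊆-finite ⊆-∪ʳ)
setEquiv-∪ d d' (both-finite h h' e) (both-finite k k' e') =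
  both-finite (∪-hasCard d h k) (∪-hasCard d' h' k') (numEquiv-+ e e')

split-≗ : ∀ A B → A ≗ (A ∩ B) ∪ (A ∖ B)
split-≗ A B i with A i | B i
... | true | true = refl
... | true | false = refl
... | false | _ = refl

split-disjoint : ∀ A B → Disjoint (A ∩ B) (A ∖ B)
split-disjoint A B i with A i | B i
... | true | true = refl
... | true | false = refl
... | false | _ = refl

count-split : ∀ A B N → count A N ≡ count (A ∩ B) N + count (A ∖ B) N
count-split A B N = trans (count-≗ (split-≗ A B) N) (count-∪ (split-disjoint A B) N)

∩-⊆ : ∀ {A B} → A ∩ B ⊆ A
∩-⊆ {A} i p with A i
... | true = refl
... | false = p

∖-⊆ : ∀ {A B} → A ∖ B ⊆ A
∖-⊆ {A} i p with A i
... | true = refl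
... | false = p

hasCard-split : ∀ {A c} B → HasCard A c → Σ ℕ λ c₁ → Σ ℕ λ c₂ →
  HasCard (A ∩ B) c₁ × HasCard (A ∖ B) c₂ × c₁ + c₂ ≡ c
hasCard-split {A} B (N , b , e) = count (A ∩ B) N , count (A ∖ B) N ,
  (N , ⊆-boundedBy ∩-⊆ b , refl) , (N , ⊆-boundedBy ∖-⊆ b , refl) , trans (sym (count-split A B N)) e

split-finite : ∀ {A} B → IsFinite (A ∩ B) → IsFinite (A ∖ B) → IsFinite A
split-finite {A} B f g = finite-≗ (sym ∘ split-≗ A B) (∪-finite f g)

<ᵇ-false : ∀ {m n} → n ≤ m → (m <ᵇ n) ≡ false
<ᵇ-false z≤n = refl
<ᵇ-false (s≤s n≤m) = <ᵇ-false n≤m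

-- The first k elements of A (all of A if it has fewer).
prefix : Subset → ℕ → Subset
prefix A k i = count A i <ᵇ k

min-step : ∀ c k → c min k + bit (c <ᵇ k) ≡ suc c min k
min-step zero zero = refl
min-step zero (suc k) = refl
min-step (suc c) zero = refl
min-step (suc c) (suc k) = cong suc (min-step c k)

count-prefix : ∀ A k N → count (A ∩ prefix A k) N ≡ count A N min k
count-prefix A k zero = refl
count-prefix A k (suc N) with A N
... | false rewrite +-identityʳ (count A N) = trans (+-identityʳ _) (count-prefix A k N)
... | true = begin
  count (A ∩ prefix A k) N + bit (count A N <ᵇ k) ≡⟨ cong (_+ bit (count A N <ᵇ k)) (count-prefix A k N) ⟩
  count A N min k + bit (count A N <ᵇ k)           ≡⟨ min-step (count A N) k ⟩
  suc (count A N) min k                            ≡⟨ cong (_min k) (+-comm 1 (count A N)) ⟩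
  (count A N + 1) min k                            ∎
  where open ≡-Reasoning

count-after-prefix : ∀ A k N → count (A ∖ prefix A k) N ≡ count A N ∸ k
count-after-prefix A k N = +-cancelˡ-≡ (count A N min k) _ _ (begin
  count A N min k + count (A ∖ prefix A k) N
    ≡⟨ cong (_+ count (A ∖ prefix A k) N) (sym (count-prefix A k N)) ⟩
  count (A ∩ prefix A k) N + count (A ∖ prefix A k) N     ≡⟨ sym (count-split A (prefix A k) N) ⟩
  count A N                                               ≡⟨ sym (m⊓n+n∸m≡n k (count A N)) ⟩
  k min count A N + (count A N ∸ k)                       ≡⟨ cong (_+ (count A N ∸ k)) (⊓-comm k (count A N)) ⟩
  count A N min k + (count A N ∸ k)                       ∎)
  where open ≡-Reasoning

prefix-finite : ∀ {A c k} → HasCard A c → k ≤ c →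
  HasCard (A ∩ prefix A k) k × HasCard (A ∖ prefix A k) (c ∸ k)
prefix-finite {A} {k = k} (N , b , refl) k≤c =
  (N , ⊆-boundedBy ∩-⊆ b , trans (count-prefix A k N) (m≥n⇒m⊓n≡n k≤c)) ,
  (N , ⊆-boundedBy ∖-⊆ b , count-after-prefix A k N)

prefix-infinite : EM → ∀ {A} k → ¬ IsFinite A →
  HasCard (A ∩ prefix A k) k × ¬ IsFinite (A ∖ prefix A k)
prefix-infinite em {A} k inf with infinite⇒unbounded em inf k
... | N , k≤ = hasCard , λ fin → inf (split-finite (prefix A k) (hasCard⇒finite hasCard) fin)
  where
  bounded : BoundedBy (A ∩ prefix A k) N
  bounded i N≤i rewrite <ᵇ-false (≤-trans k≤ (count-mono A N≤i)) = ∧-zeroʳ (A i)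
  hasCard : HasCard (A ∩ prefix A k) k
  hasCard = N , bounded , trans (count-prefix A k N) (m≥n⇒m⊓n≡n k≤)

-- An infinite set splits into two infinite halves by taking every other element.
even : ℕ → Bool
even zero = true
even (suc n) = not (even n)

evenPart : Subset → Subset
evenPart A i = even (count A i)

count-evenPart : ∀ A N →
  count (A ∩ evenPart A) N ≡ count (A ∖ evenPart A) N + bit (not (even (count A N)))
count-evenPart A zero = refl
count-evenPart A (suc N) with A N
... | false rewrite +-identityʳ (count A N) | +-identityʳ (count (A ∩ evenPart A) N)
                  | +-identityʳ (count (A ∖ evenPart A) N) = count-evenPart A N
... | true rewrite +-comm (count A N) 1 | not-involutive (even (count A N)) =
  cong (_+ bit (even (count A N))) (count-evenPart A N)

balanced-split-infinite : EM → ∀ {A B C} → ¬ IsFinite A →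
  (∀ N → count A N ≡ count B N + count C N) → (∀ N → count B N ≤ suc (count C N)) → ¬ IsFinite C
balanced-split-infinite em {A} {B} {C} inf total ahead (N₀ , b)
  with infinite⇒unbounded em inf (suc (suc (count C N₀) + count C N₀))
... | N , many = 1+n≰n (begin
  suc (suc (count C N₀) + count C N₀)  ≤⟨ many ⟩
  count A N                            ≡⟨ total N ⟩
  count B N + count C N                ≤⟨ +-monoˡ-≤ (count C N) (ahead N) ⟩
  suc (count C N) + count C N          ≤⟨ +-mono-≤ (s≤s C≤) C≤ ⟩
  suc (count C N₀) + count C N₀        ∎)
  where
  open ≤-Reasoning
  C≤ : count C N ≤ count C N₀
  C≤ = count≤count-at-bound C b N

bit≤1 : ∀ b → bit b ≤ 1
bit≤1 false = z≤n
bit≤1 true = ≤-refl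

evenPart-infinite : EM → ∀ {A} → ¬ IsFinite A →
  ¬ IsFinite (A ∩ evenPart A) × ¬ IsFinite (A ∖ evenPart A)
evenPart-infinite em {A} inf =
  balanced-split-infinite em inf (λ N → trans (count-split A E N) (+-comm (count (A ∩ E) N) _)) odd-ahead ,
  balanced-split-infinite em inf (count-split A E) even-ahead
  where
  E = evenPart A
  even-ahead : ∀ N → count (A ∩ E) N ≤ suc (count (A ∖ E) N)
  even-ahead N = begin
    count (A ∩ E) N                                       ≡⟨ count-evenPart A N ⟩
    count (A ∖ E) N + bit (not (even (count A N)))        ≤⟨ +-monoʳ-≤ (count (A ∖ E) N) (bit≤1 _) ⟩
    count (A ∖ E) N + 1                                   ≡⟨ +-comm _ 1 ⟩
    suc (count (A ∖ E) N)                                 ∎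
    where open ≤-Reasoning
  odd-ahead : ∀ N → count (A ∖ E) N ≤ suc (count (A ∩ E) N)
  odd-ahead N = begin
    count (A ∖ E) N                                       ≤⟨ m≤m+n _ _ ⟩
    count (A ∖ E) N + bit (not (even (count A N)))        ≡⟨ sym (count-evenPart A N) ⟩
    count (A ∩ E) N                                       ≤⟨ n≤1+n _ ⟩
    suc (count (A ∩ E) N)                                 ∎
    where open ≤-Reasoning

SplitOf : (M T c' c₁ c₂ : ℕ) → Set
SplitOf M T c' c₁ c₂ = Σ ℕ λ k → k ≤ c' × NumEquiv M T c₁ k × NumEquiv M T c₂ (c' ∸ k)

splitOf-swap : ∀ {M T c' c₁ c₂} → SplitOf M T c' c₁ c₂ → SplitOf M T c' c₂ c₁
splitOf-swap {M} {T} {c'} {c₁} (k , k≤c' , e₁ , e₂) =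
  c' ∸ k , m∸n≤m c' k , e₂ , subst (NumEquiv M T c₁) (sym (m∸[m∸n]≡n k≤c')) e₁

small+sum⇒large : ∀ {T x y} → x < T → T + T ≤ x + y → T ≤ y
small+sum⇒large x<T TT≤ = ≮⇒≥ (λ y<T → <⇒≱ (+-mono-< x<T y<T) TT≤)

-- If the first part is below the threshold, it is copied exactly.
split-small : ∀ {M T c' c₁ c₂} → c₁ < T → T + T ≤ c₁ + c₂ → T + T ≤ c' →
  c₁ + c₂ ≡ c' mod M → SplitOf M T c' c₁ c₂
split-small {M} {T} {c'} {c₁} {c₂} c₁<T TT≤c TT≤c' c≡c' =
  c₁ , c₁≤c' , equal refl , large (small+sum⇒large c₁<T TT≤c) T≤rest c₂≡rest
  where
  c₁≤c' : c₁ ≤ c'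
  c₁≤c' = ≤-trans (<⇒≤ c₁<T) (≤-trans (m≤m+n T T) TT≤c')
  c'≡ : c₁ + (c' ∸ c₁) ≡ c'
  c'≡ = m+[n∸m]≡n c₁≤c'
  T≤rest : T ≤ c' ∸ c₁
  T≤rest = small+sum⇒large c₁<T (subst (T + T ≤_) (sym c'≡) TT≤c')
  c₂≡rest : c₂ ≡ c' ∸ c₁ mod M
  c₂≡rest = mod-cancelˡ (subst (λ x → c₁ + c₂ ≡ x mod M) (sym c'≡) c≡c') mod-refl

-- If both parts are large, c₁ is matched by the least representative ≥ T of its class mod M.
split-large : ∀ {M T c' c₁ c₂} .{{_ : NonZero M}} → T ≤ c₁ → T ≤ c₂ → T + M + T ≤ c' →
  c₁ + c₂ ≡ c' mod M → SplitOf M T c' c₁ c₂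
split-large {M} {T} {c'} {c₁} {c₂} T≤c₁ T≤c₂ bound c≡c' =
  k , k≤c' , c₁≈k , large T≤c₂ T≤rest c₂≡rest
  where
  k = T + (c₁ ∸ T) % M
  k<T+M : k < T + M
  k<T+M = +-monoʳ-< T (m%n<n (c₁ ∸ T) M)
  k≤c' : k ≤ c'
  k≤c' = ≤-trans (<⇒≤ k<T+M) (≤-trans (m≤m+n (T + M) T) bound)
  c₁≡ : c₁ ≡ k + (c₁ ∸ T) / M * M
  c₁≡ = begin
    c₁                                      ≡⟨ sym (m+[n∸m]≡n T≤c₁) ⟩
    T + (c₁ ∸ T)                            ≡⟨ cong (_+_ T) (m≡m%n+[m/n]*n (c₁ ∸ T) M) ⟩
    T + ((c₁ ∸ T) % M + (c₁ ∸ T) / M * M)   ≡⟨ sym (+-assoc T _ _) ⟩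
    k + (c₁ ∸ T) / M * M                    ∎
    where open ≡-Reasoning
  c₁≈k : NumEquiv M T c₁ k
  c₁≈k = large T≤c₁ (m≤m+n T _) (mod-by-multiple ((c₁ ∸ T) / M) c₁≡)
  T≤rest : T ≤ c' ∸ k
  T≤rest = m+n≤o⇒m≤o∸n T (≤-trans (≤-reflexive (+-comm T k))
                                  (≤-trans (+-monoˡ-≤ T (<⇒≤ k<T+M)) bound))
  c₂≡rest : c₂ ≡ c' ∸ k mod M
  c₂≡rest = mod-cancelˡ (subst (λ x → c₁ + c₂ ≡ x mod M) (sym (m+[n∸m]≡n k≤c')) c≡c')
                        (numEquiv⇒mod c₁≈k)

T+T≤T+M+T : ∀ T M → T + T ≤ T + M + T
T+T≤T+M+T T M = +-monoˡ-≤ T (m≤m+n T M)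

split-number : ∀ {M T c c' c₁ c₂} .{{_ : NonZero M}} → NumEquiv M (T + M + T) c c' → c₁ + c₂ ≡ c →
  SplitOf M T c' c₁ c₂
split-number {c₁ = c₁} {c₂} (equal refl) refl =
  c₁ , m≤m+n c₁ c₂ , equal refl , equal (sym (m+n∸m≡n c₁ c₂))
split-number {M} {T} {c' = c'} {c₁} {c₂} (large Tc Tc' c≡c') refl with c₁ <? T | c₂ <? T
... | yes c₁<T | _ = split-small c₁<T (≤-trans (T+T≤T+M+T T M) Tc) (≤-trans (T+T≤T+M+T T M) Tc') c≡c'
... | no _ | yes c₂<T = splitOf-swap (split-small c₂<T
        (≤-trans (T+T≤T+M+T T M) (subst (T + M + T ≤_) (+-comm c₁ c₂) Tc)) (≤-trans (T+T≤T+M+T T M) Tc')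
        (subst (λ x → x ≡ c' mod M) (+-comm c₁ c₂) c≡c'))
... | no c₁≮T | no c₂≮T = split-large (≮⇒≥ c₁≮T) (≮⇒≥ c₂≮T) Tc' c≡c'

split-set : EM → ∀ {M T A A'} .{{_ : NonZero M}} → SetEquiv M (T + M + T) A A' → ∀ Y →
  Σ Subset λ Y' → SetEquiv M T (A ∩ Y) (A' ∩ Y') × SetEquiv M T (A ∖ Y) (A' ∖ Y')
split-set em (both-finite h h' e) Y with hasCard-split Y h
... | c₁ , c₂ , h₁ , h₂ , sum with split-number e sum
... | k , k≤ , e₁ , e₂ with prefix-finite h' k≤
... | hk , hrest = prefix _ k , both-finite h₁ hk e₁ , both-finite h₂ hrest e₂
split-set em {A = A} {A'} (both-infinite inf inf') Y with em {IsFinite (A ∩ Y)} | em {IsFinite (A ∖ Y)}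
... | yes fin | _ with finite⇒hasCard fin
... | c , h with prefix-infinite em c inf'
... | hk , inf-rest =
  prefix A' c , both-finite h hk (equal refl) , both-infinite (inf ∘ split-finite Y fin) inf-rest
split-set em {A = A} {A'} (both-infinite inf inf') Y | no _ | yes fin with finite⇒hasCard fin
... | c , h with prefix-infinite em c inf'
... | hk , inf-rest = Y' , both-infinite (inf ∘ flip (split-finite Y) fin) inf-rest ,
  both-finite h (hasCard-≗ (λ i → cong (A' i ∧_) (sym (not-involutive (prefix A' c i)))) hk) (equal refl)
  where
  Y' = not ∘ prefix A' c
split-set em {A = A} {A'} (both-infinite inf inf') Y | no ¬fin₁ | no ¬fin₂ with evenPart-infinite em inf'
... | inf₁ , inf₂ = evenPart A' , both-infinite ¬fin₁ inf₁ , both-infinite ¬fin₂ inf₂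

tail : ∀ {n} → Env (suc n) → Env n
tail ρ i = ρ (suc i)

-- EnvEquiv n M T U U' ρ ρ': each of the 2ⁿ Boolean cells of ρ inside U (the intersections of U
-- with the variables or their complements) is (M,T)-equivalent to the corresponding cell of ρ'
-- inside U'.
EnvEquiv : ∀ n → (M T : ℕ) → Subset → Subset → Env n → Env n → Set
EnvEquiv zero M T U U' ρ ρ' = SetEquiv M T U U'
EnvEquiv (suc n) M T U U' ρ ρ' =
  EnvEquiv n M T (U ∩ ρ zero) (U' ∩ ρ' zero) (tail ρ) (tail ρ') ×
  EnvEquiv n M T (U ∖ ρ zero) (U' ∖ ρ' zero) (tail ρ) (tail ρ')

envEquiv-sym : ∀ n {M T U U' ρ ρ'} → EnvEquiv n M T U U' ρ ρ' → EnvEquiv n M T U' U ρ' ρ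
envEquiv-sym zero e = setEquiv-sym e
envEquiv-sym (suc n) (e₁ , e₂) = envEquiv-sym n e₁ , envEquiv-sym n e₂

envEquiv-weaken : ∀ n {M T M' T' U U' ρ ρ'} → M' ℕD.∣ M → T' ≤ T →
  EnvEquiv n M T U U' ρ ρ' → EnvEquiv n M' T' U U' ρ ρ'
envEquiv-weaken zero d le e = setEquiv-weaken d le e
envEquiv-weaken (suc n) d le (e₁ , e₂) = envEquiv-weaken n d le e₁ , envEquiv-weaken n d le e₂

envEquiv-≗ : ∀ n {M T U U' V V' ρ ρ'} → U ≗ V → U' ≗ V' →
  EnvEquiv n M T U U' ρ ρ' → EnvEquiv n M T V V' ρ ρ'
envEquiv-≗ zero e e' h = setEquiv-≗ e e' h
envEquiv-≗ (suc n) {ρ = ρ} {ρ'} e e' (h₁ , h₂) =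
  envEquiv-≗ n (λ i → cong (_∧ ρ zero i) (e i)) (λ i → cong (_∧ ρ' zero i) (e' i)) h₁ ,
  envEquiv-≗ n (λ i → cong (_∧ not (ρ zero i)) (e i)) (λ i → cong (_∧ not (ρ' zero i)) (e' i)) h₂

-- Membership in the set  if r then Y₁ else Y₂, restricted to the cells r and ¬r.
∧-select : ∀ u r y₁ y₂ (g : Bool → Bool) → (u ∧ r) ∧ g y₁ ≡ (u ∧ g (if r then y₁ else y₂)) ∧ r
∧-select u true y₁ y₂ g = ∧-swapʳ u true (g y₁)
∧-select u false y₁ y₂ g = trans (cong (_∧ g y₁) (∧-zeroʳ u)) (sym (∧-zeroʳ _))

∧-select-not : ∀ u r y₁ y₂ (g : Bool → Bool) →
  (u ∧ not r) ∧ g y₂ ≡ (u ∧ g (if r then y₁ else y₂)) ∧ not r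
∧-select-not u true y₁ y₂ g = trans (cong (_∧ g y₂) (∧-zeroʳ u)) (sym (∧-zeroʳ _))
∧-select-not u false y₁ y₂ g = ∧-swapʳ u true (g y₂)

-- Back-and-forth: an equivalence at threshold T + M + T can be extended by one more set on each
-- side.  The new set Y' is assembled cell by cell from the splitting lemma for sets.
extend : EM → ∀ n {M T U U' ρ ρ'} .{{_ : NonZero M}} → EnvEquiv n M (T + M + T) U U' ρ ρ' → ∀ Y →
  Σ Subset λ Y' → EnvEquiv n M T (U ∩ Y) (U' ∩ Y') ρ ρ' × EnvEquiv n M T (U ∖ Y) (U' ∖ Y') ρ ρ'
extend em zero e Y = split-set em e Y
extend em (suc n) {U = U} {U'} {ρ} {ρ'} (e₁ , e₂) Y with extend em n e₁ Y | extend em n e₂ Y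
... | Y₁ , in₁ , out₁ | Y₂ , in₂ , out₂ = Y' ,
  (envEquiv-≗ n (swap (ρ zero) id) (select id) in₁ ,
   envEquiv-≗ n (swap (not ∘ ρ zero) id) (select-not id) in₂) ,
  (envEquiv-≗ n (swap (ρ zero) not) (select not) out₁ ,
   envEquiv-≗ n (swap (not ∘ ρ zero) not) (select-not not) out₂)
  where
  Y' : Subset
  Y' i = if ρ' zero i then Y₁ i else Y₂ i
  -- Refining a cell r of U by Y is refining U ∩ Y by r (g = not handles the complement of Y).
  swap : (r : Subset) (g : Bool → Bool) →
    (λ i → (U i ∧ r i) ∧ g (Y i)) ≗ (λ i → (U i ∧ g (Y i)) ∧ r i)
  swap r g i = ∧-swapʳ (U i) (r i) (g (Y i))
  select : (g : Bool → Bool) →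
    (λ i → (U' i ∧ ρ' zero i) ∧ g (Y₁ i)) ≗ (λ i → (U' i ∧ g (Y' i)) ∧ ρ' zero i)
  select g i = ∧-select (U' i) (ρ' zero i) (Y₁ i) (Y₂ i) g
  select-not : (g : Bool → Bool) →
    (λ i → (U' i ∧ not (ρ' zero i)) ∧ g (Y₂ i)) ≗ (λ i → (U' i ∧ g (Y' i)) ∧ not (ρ' zero i))
  select-not g i = ∧-select-not (U' i) (ρ' zero i) (Y₁ i) (Y₂ i) g

profile : ∀ {n} → Env n → ℕ → Vec Bool n
profile ρ i = tabulate (λ j → ρ j i)

⟦_⟧ : ∀ {n} → Term n → Vec Bool n → Bool
⟦ var j ⟧ v = lookup v j
⟦ 𝟘 ⟧ v = false
⟦ 𝟙 ⟧ v = true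
⟦ s ⊓ t ⟧ v = ⟦ s ⟧ v ∧ ⟦ t ⟧ v
⟦ s ⊔ t ⟧ v = ⟦ s ⟧ v ∨ ⟦ t ⟧ v
⟦ ∁ t ⟧ v = not (⟦ t ⟧ v)

evalT-profile : ∀ {n} (t : Term n) ρ i → evalT t ρ i ≡ ⟦ t ⟧ (profile ρ i)
evalT-profile (var j) ρ i = sym (lookup∘tabulate (λ j → ρ j i) j)
evalT-profile 𝟘 ρ i = refl
evalT-profile 𝟙 ρ i = refl
evalT-profile (s ⊓ t) ρ i = cong₂ _∧_ (evalT-profile s ρ i) (evalT-profile t ρ i)
evalT-profile (s ⊔ t) ρ i = cong₂ _∨_ (evalT-profile s ρ i) (evalT-profile t ρ i)
evalT-profile (∁ t) ρ i = cong not (evalT-profile t ρ i)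

shannon : ∀ u r (g : Bool → Bool) → u ∧ g r ≡ ((u ∧ r) ∧ g true) ∨ ((u ∧ not r) ∧ g false)
shannon false r g = refl
shannon true true g with g true
... | true = refl
... | false = refl
shannon true false g = refl

shannon-disjoint : ∀ u r a b → ((u ∧ r) ∧ a) ∧ ((u ∧ not r) ∧ b) ≡ false
shannon-disjoint false r a b = refl
shannon-disjoint true true a b = ∧-zeroʳ a
shannon-disjoint true false a b = refl

-- Every set described by a Boolean function of the profile is a disjoint union of cells, so
-- equivalence of all cells gives equivalence of the described sets.
envEquiv-boolean : ∀ n {M T U U' ρ ρ'} → EnvEquiv n M T U U' ρ ρ' → ∀ (f : Vec Bool n → Bool) →
  SetEquiv M T (λ i → U i ∧ f (profile ρ i)) (λ i → U' i ∧ f (profile ρ' i))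
envEquiv-boolean zero e f with f []
... | true = setEquiv-≗ (λ i → sym (∧-identityʳ _)) (λ i → sym (∧-identityʳ _)) e
... | false = setEquiv-≗ (λ i → sym (∧-zeroʳ _)) (λ i → sym (∧-zeroʳ _)) setEquiv-∅
envEquiv-boolean (suc n) {U = U} {U'} {ρ} {ρ'} (e₁ , e₂) f =
  setEquiv-≗ (λ i → sym (shannon (U i) (ρ zero i) (λ b → f (b ∷ profile (tail ρ) i))))
             (λ i → sym (shannon (U' i) (ρ' zero i) (λ b → f (b ∷ profile (tail ρ') i))))
             (setEquiv-∪ (λ i → shannon-disjoint (U i) (ρ zero i) _ _)
                         (λ i → shannon-disjoint (U' i) (ρ' zero i) _ _)
                         (envEquiv-boolean n e₁ (f ∘ (true ∷_)))
                         (envEquiv-boolean n e₂ (f ∘ (false ∷_))))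

envEquiv-term : ∀ n {M T ρ ρ'} → EnvEquiv n M T ω ω ρ ρ' → ∀ t → SetEquiv M T (evalT t ρ) (evalT t ρ')
envEquiv-term n {ρ = ρ} {ρ'} e t =
  setEquiv-≗ (sym ∘ evalT-profile t ρ) (sym ∘ evalT-profile t ρ') (envEquiv-boolean n e ⟦ t ⟧)

setEquiv-empty : ∀ {M T A A'} → 1 ≤ T → SetEquiv M T A A' → HasCard A 0 → HasCard A' 0
setEquiv-empty _ (both-infinite inf _) h = ⊥-elim (inf (hasCard⇒finite h))
setEquiv-empty 1≤T (both-finite h h' e) h₀ with hasCard-unique h₀ h
... | refl with e
... | equal refl = h'
... | large T≤0 _ _ = ⊥-elim (1+n≰n (≤-trans 1≤T T≤0))

setEquiv-finite : ∀ {M T A A'} → SetEquiv M T A A' → IsFinite A → IsFinite A'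
setEquiv-finite (both-infinite inf _) fin = ⊥-elim (inf fin)
setEquiv-finite (both-finite _ h' _) _ = hasCard⇒finite h'

setEquiv-atLeast : EM → ∀ {M T A A' k} → k ≤ T → SetEquiv M T A A' → AtLeast k A → AtLeast k A'
setEquiv-atLeast em {k = k} _ (both-infinite _ inf') _ = infinite⇒unbounded em inf' k
setEquiv-atLeast em {A = A} {k = k} k≤T (both-finite (N , b , refl) (N' , _ , refl) e) (N₀ , k≤) =
  N' , k≤c' e
  where
  k≤c : k ≤ count A N
  k≤c = ≤-trans k≤ (count≤count-at-bound A b N₀)
  k≤c' : ∀ {c'} → NumEquiv _ _ (count A N) c' → k ≤ c'
  k≤c' (equal refl) = k≤c
  k≤c' (large _ T≤c' _) = ≤-trans k≤T T≤c'

setEquiv-res : ∀ {M T A A' n s} → n ℕD.∣ M → SetEquiv M T A A' → ResPred n s A → ResPred n s A'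
setEquiv-res d (both-infinite inf _) (_ , h , _) = ⊥-elim (inf (hasCard⇒finite h))
setEquiv-res {s = s} d (both-finite {c' = c'} h h' e) (c , h₀ , r) with hasCard-unique h₀ h
... | refl = c' , h' , mod-residue {s = s} (mod-∣ d (numEquiv⇒mod e)) r

xor≡false⇒≡ : ∀ a b → a xor b ≡ false → a ≡ b
xor≡false⇒≡ true true _ = refl
xor≡false⇒≡ false false _ = refl

modulus : ∀ {p n} → Formula p n → ℕ
modulus (Res q m _ _ _ _ _) = q ^ m
modulus (φ ∧′ ψ) = modulus φ * modulus ψ
modulus (φ ∨′ ψ) = modulus φ * modulus ψ
modulus (φ ⇒′ ψ) = modulus φ * modulus ψ
modulus (¬′ φ) = modulus φ
modulus (∀′ φ) = modulus φ
modulus (∃′ φ) = modulus φ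
modulus _ = 1

threshold : ∀ {p n} → Formula p n → ℕ
threshold (s ≐ t) = 1
threshold (Cₖ k _ _) = k
threshold (φ ∧′ ψ) = threshold φ + threshold ψ
threshold (φ ∨′ ψ) = threshold φ + threshold ψ
threshold (φ ⇒′ ψ) = threshold φ + threshold ψ
threshold (¬′ φ) = threshold φ
threshold (∀′ φ) = threshold φ + modulus φ + threshold φ
threshold (∃′ φ) = threshold φ + modulus φ + threshold φ
threshold _ = 0

modulus-nonZero : ∀ {p n} (φ : Formula p n) → NonZero (modulus φ)
modulus-nonZero (s ≐ t) = _
modulus-nonZero (Cₖ k x t) = _
modulus-nonZero (Fin′ t) = _
modulus-nonZero (Res q m q-prime _ _ _ _) = m^n≢0 q m {{prime⇒nonZero q-prime}}
modulus-nonZero ⊥′ = _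
modulus-nonZero (φ ∧′ ψ) = m*n≢0 (modulus φ) (modulus ψ) {{modulus-nonZero φ}} {{modulus-nonZero ψ}}
modulus-nonZero (φ ∨′ ψ) = m*n≢0 (modulus φ) (modulus ψ) {{modulus-nonZero φ}} {{modulus-nonZero ψ}}
modulus-nonZero (φ ⇒′ ψ) = m*n≢0 (modulus φ) (modulus ψ) {{modulus-nonZero φ}} {{modulus-nonZero ψ}}
modulus-nonZero (¬′ φ) = modulus-nonZero φ
modulus-nonZero (∀′ φ) = modulus-nonZero φ
modulus-nonZero (∃′ φ) = modulus-nonZero φ

envEquiv-left : ∀ n {M₁ M₂ T₁ T₂ U U' ρ ρ'} →
  EnvEquiv n (M₁ * M₂) (T₁ + T₂) U U' ρ ρ' → EnvEquiv n M₁ T₁ U U' ρ ρ'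
envEquiv-left n {M₁} {M₂} {T₁} {T₂} = envEquiv-weaken n (ℕD.m∣m*n M₂) (m≤m+n T₁ T₂)

envEquiv-right : ∀ n {M₁ M₂ T₁ T₂ U U' ρ ρ'} →
  EnvEquiv n (M₁ * M₂) (T₁ + T₂) U U' ρ ρ' → EnvEquiv n M₂ T₂ U U' ρ ρ'
envEquiv-right n {M₁} {M₂} {T₁} {T₂} = envEquiv-weaken n (ℕD.n∣m*n M₁) (m≤n+m T₂ T₁)

transfer : EM → ∀ {p n} (φ : Formula p n) {ρ ρ'} →
  EnvEquiv n (modulus φ) (threshold φ) ω ω ρ ρ' → Sat φ ρ → Sat φ ρ'
transfer em {n = n} (s ≐ t) {ρ} {ρ'} e s≐t i = begin
  evalT s ρ' i                ≡⟨ evalT-profile s ρ' i ⟩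
  ⟦ s ⟧ (profile ρ' i)        ≡⟨ xor≡false⇒≡ _ _ (hasCard0⇒empty diff'-empty i) ⟩
  ⟦ t ⟧ (profile ρ' i)        ≡⟨ sym (evalT-profile t ρ' i) ⟩
  evalT t ρ' i                ∎
  where
  open ≡-Reasoning
  differ : Vec Bool n → Bool
  differ v = ⟦ s ⟧ v xor ⟦ t ⟧ v
  agree : ∀ i → ⟦ s ⟧ (profile ρ i) ≡ ⟦ t ⟧ (profile ρ i)
  agree i = trans (sym (evalT-profile s ρ i)) (trans (s≐t i) (evalT-profile t ρ i))
  diff-empty : HasCard (λ i → differ (profile ρ i)) 0
  diff-empty = empty⇒hasCard0 (λ i →
    subst (λ b → ⟦ s ⟧ (profile ρ i) xor b ≡ false) (agree i) (xor-same (⟦ s ⟧ (profile ρ i))))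
  diff'-empty : HasCard (λ i → differ (profile ρ' i)) 0
  diff'-empty = setEquiv-empty ≤-refl (envEquiv-boolean n e differ) diff-empty
transfer em {n = n} (Cₖ k _ t) e = setEquiv-atLeast em ≤-refl (envEquiv-term n e t)
transfer em {n = n} (Fin′ t) e = setEquiv-finite (envEquiv-term n e t)
transfer em {n = n} (Res q m _ _ _ s t) e = setEquiv-res {s = s} ℕD.∣-refl (envEquiv-term n e t)
transfer em ⊥′ e ()
transfer em {n = n} (φ ∧′ ψ) e (sφ , sψ) =
  transfer em φ (envEquiv-left n e) sφ , transfer em ψ (envEquiv-right n {modulus φ} e) sψ
transfer em {n = n} (φ ∨′ ψ) e (inj₁ sφ) = inj₁ (transfer em φ (envEquiv-left n e) sφ)
transfer em {n = n} (φ ∨′ ψ) e (inj₂ sψ) = inj₂ (transfer em ψ (envEquiv-right n {modulus φ} e) sψ)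
transfer em {n = n} (φ ⇒′ ψ) e sφ⇒sψ sφ' =
  transfer em ψ (envEquiv-right n {modulus φ} e) (sφ⇒sψ (transfer em φ (envEquiv-sym n (envEquiv-left n e)) sφ'))
transfer em {n = n} (¬′ φ) e ¬sφ sφ' = ¬sφ (transfer em φ (envEquiv-sym n e) sφ')
transfer em {n = n} (∀′ φ) {ρ} {ρ'} e ∀sφ y' with extend em n {{modulus-nonZero φ}} (envEquiv-sym n e) y'
... | y , e₁ , e₂ =
  transfer em φ (envEquiv-sym (suc n) {ρ = y' VF.∷ ρ'} {ρ' = y VF.∷ ρ} (e₁ , e₂)) (∀sφ y)
transfer em {n = n} (∃′ φ) e (y , sφ) with extend em n {{modulus-nonZero φ}} e y
... | y' , e₁ , e₂ = y' , transfer em φ (e₁ , e₂) sφ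

prime∤1 : ∀ {p} → Prime p → ¬ p ℕD.∣ 1
prime∤1 p-prime d = ¬prime[1] (subst Prime (ℕD.∣1⇒≡1 d) p-prime)

prime∤* : ∀ {p a b} → Prime p → ¬ p ℕD.∣ a → ¬ p ℕD.∣ b → ¬ p ℕD.∣ a * b
prime∤* {a = a} {b} p-prime p∤a p∤b d with euclidsLemma a b p-prime d
... | inj₁ p∣a = p∤a p∣a
... | inj₂ p∣b = p∤b p∣b

prime∤prime-power : ∀ {p q} → Prime p → Prime q → q ≢ p → ∀ m → ¬ p ℕD.∣ q ^ m
prime∤prime-power p-prime q-prime q≢p zero = prime∤1 p-prime
prime∤prime-power p-prime q-prime q≢p (suc m) = prime∤* p-prime p∤q (prime∤prime-power p-prime q-prime q≢p m)
  where
  p∤q : ¬ _ ℕD.∣ _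
  p∤q d with prime⇒irreducible q-prime d
  ... | inj₁ p≡1 = ¬prime[1] (subst Prime p≡1 p-prime)
  ... | inj₂ p≡q = q≢p (sym p≡q)

modulus-coprime : ∀ {p n} → Prime p → (φ : Formula p n) → ¬ p ℕD.∣ modulus φ
modulus-coprime p-prime (Res q m q-prime q≢p _ _ _) = prime∤prime-power p-prime q-prime q≢p m
modulus-coprime p-prime (φ ∧′ ψ) = prime∤* p-prime (modulus-coprime p-prime φ) (modulus-coprime p-prime ψ)
modulus-coprime p-prime (φ ∨′ ψ) = prime∤* p-prime (modulus-coprime p-prime φ) (modulus-coprime p-prime ψ)
modulus-coprime p-prime (φ ⇒′ ψ) = prime∤* p-prime (modulus-coprime p-prime φ) (modulus-coprime p-prime ψ)
modulus-coprime p-prime (¬′ φ) = modulus-coprime p-prime φ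
modulus-coprime p-prime (∀′ φ) = modulus-coprime p-prime φ
modulus-coprime p-prime (∃′ φ) = modulus-coprime p-prime φ
modulus-coprime p-prime (s ≐ t) = prime∤1 p-prime
modulus-coprime p-prime (Cₖ k _ t) = prime∤1 p-prime
modulus-coprime p-prime (Fin′ t) = prime∤1 p-prime
modulus-coprime p-prime ⊥′ = prime∤1 p-prime

initial : ℕ → Subset
initial a i = i <ᵇ a

count-initial : ∀ a N → count (initial a) N ≡ N min a
count-initial a zero = refl
count-initial a (suc N) = trans (cong (_+ bit (N <ᵇ a)) (count-initial a N)) (min-step N a)

initial-hasCard : ∀ a → HasCard (initial a) a
initial-hasCard a = a , (λ i a≤i → <ᵇ-false a≤i) , trans (count-initial a a) (⊓-idem a)

co-initial-infinite : ∀ a → ¬ IsFinite (ω ∖ initial a)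
co-initial-infinite a (N , b) with trans (cong not (sym (<ᵇ-false (m≤n+m a N)))) (b (N + a) (m≤m+n N a))
... | ()

initial-equiv : ∀ {M T a} → T ≤ a → EnvEquiv 1 M T ω ω (λ _ → initial a) (λ _ → initial (a + M))
initial-equiv {M} {T} {a} T≤a =
  both-finite (initial-hasCard a) (initial-hasCard (a + M))
    (large T≤a (≤-trans T≤a (m≤m+n a M)) (mod-sym (mod-by-multiple 1 (cong (_+_ a) (sym (+-identityʳ M)))))) ,
  both-infinite (co-initial-infinite a) (co-initial-infinite (a + M))

representative : (p : ℕ) .{{_ : NonZero p}} → ℤ → ℕ → ℕ
representative p r T = r %ℕ p + T * p

representative-large : ∀ p .{{_ : NonZero p}} r T → T ≤ representative p r T
representative-large p r T = ≤-trans (m≤m*n T p) (m≤n+m (T * p) (r %ℕ p))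

representative-residue : ∀ p .{{_ : NonZero p}} r T → + p ℤD.∣ (+ representative p r T ℤ.- r)
representative-residue p r T = ℤS.∣⇒∣ᵤ (ℤS.divides (+ T ℤ.- r /ℕ p) (begin
  + (r %ℕ p + T * p) ℤ.- r
    ≡⟨ cong₂ ℤ._-_ (trans (ℤP.pos-+ (r %ℕ p) (T * p)) (cong (ℤ._+_ (+ (r %ℕ p))) (ℤP.pos-* T p)))
                   (a≡a%ℕn+[a/ℕn]*n r p) ⟩
  (+ (r %ℕ p) ℤ.+ + T ℤ.* + p) ℤ.- (+ (r %ℕ p) ℤ.+ (r /ℕ p) ℤ.* + p)
    ≡⟨ difference-of-multiples (+ (r %ℕ p)) (+ T) (r /ℕ p) (+ p) ⟩
  (+ T ℤ.- r /ℕ p) ℤ.* + p ∎))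
  where
  open ≡-Reasoning
  difference-of-multiples : ∀ x s t y → (x ℤ.+ s ℤ.* y) ℤ.- (x ℤ.+ t ℤ.* y) ≡ (s ℤ.- t) ℤ.* y
  difference-of-multiples = solve-∀

Defines : (p : ℕ) → Formula p 1 → (Subset → Set) → Set
Defines p φ P = ∀ x → (Sat φ (λ _ → x) → P x) × (P x → Sat φ (λ _ → x))

resPred-size : ∀ {A n s c} → ResPred n s A → HasCard A c → + n ℤD.∣ (+ c ℤ.- s)
resPred-size (c₀ , h₀ , r) h with hasCard-unique h₀ h
... | refl = r

-- If φ defines Res(p, r), the initial segments of sizes a and a + modulus φ (a ≥ threshold φ,
-- a ≡ r mod p) both satisfy it, hence p divides the modulus of φ.
defining-formula⇒p∣modulus : EM → ∀ {p r a} (φ : Formula p 1) → Defines p φ (ResPred p r) →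
  threshold φ ≤ a → + p ℤD.∣ (+ a ℤ.- r) → p ℕD.∣ modulus φ
defining-formula⇒p∣modulus em {p} {r} {a} φ defines T≤a a≡r =
  mod-shift⇒∣ (residue⇒mod {s = r} shifted-size a≡r)
  where
  shifted : Subset
  shifted = initial (a + modulus φ)
  shifted-sat : Sat φ (λ _ → shifted)
  shifted-sat = transfer em φ (initial-equiv T≤a) (proj₂ (defines (initial a)) (a , initial-hasCard a , a≡r))
  shifted-size : + p ℤD.∣ (+ (a + modulus φ) ℤ.- r)
  shifted-size = resPred-size {s = r} (proj₁ (defines shifted) shifted-sat) (initial-hasCard (a + modulus φ))

-- A defining formula would make p divide its own modulus, which is prime to p.
theorem5 : ExcludedMiddle 0ℓ → (p : ℕ) → Prime p → (r : ℤ) →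
    ¬ Definable p (ResPred p r)
theorem5 em p p-prime r (φ , defines) = modulus-coprime p-prime φ
  (defining-formula⇒p∣modulus em {r = r} φ defines
    (representative-large p r (threshold φ)) (representative-residue p r (threshold φ)))
  where
  instance
    p≢0 : NonZero p
    p≢0 = prime⇒nonZero p-prime
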